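{- Let $q$ be a prime power and $\mathcal{S}_q=\{x^2:x\in\mathbb{F}_q^\times\}$. For any $Y\subseteq\mathbb{F}_q$, $a\in\mathbb{F}_q^\times$ and $b\in\mathbb{F}_q$, $Y$ is shattered by $\mathcal{S}_q$ if and only if $aY+b=\{ay+b: y\in Y\}$ is shattered by $\mathcal{S}_q$.
   Context: For $x\in\mathbb{F}_q$ write $\mathcal{S}_q+x=\{z+x:z\in\mathcal{S}_q\}$. A set $Y=\{y_1,\dots,y_n\}\subseteq\mathbb{F}_q$ (with $n$ distinct elements) is shattered by $\mathcal{S}_q$ if for every subset $A\subseteq Y$ (including $\emptyset$ and $Y$) there exists $x\in\mathbb{F}_q$ with $x\notin Y$ such that for all $j$, $y_j\in A$ if and only if $y_j\in\mathcal{S}_q+x$. -}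

module Defs where

open import Level using (0ℓ)
open import Data.Nat using (ℕ)
open import Data.Fin using (Fin)
open import Data.Fin.Subset using (Subset; _∈_)
open import Data.Product using (Σ; _×_)
open import Function.Bundles using (_↔_; _⇔_)
open import Relation.Binary.PropositionalEquality using (_≡_; _≢_)
open import Algebra.Structures using (IsCommutativeRing)

-- A finite field: a commutative ring (with propositional equality) in which
-- 0 ≠ 1 and every nonzero element has a multiplicative inverse, whose carrier
-- is in bijection with Fin size.  (size is then automatically a prime power q,
-- and the field is F_q.)
record FiniteField : Set₁ where
  infixl 6 _+_
  infixl 7 _*_
  field
    Carrier : Set
    _+_ _*_ : Carrier → Carrier → Carrier
    -_ : Carrier → Carrier
    0# 1# : Carrier
    isCommutativeRing : IsCommutativeRing _≡_ _+_ _*_ -_ 0# 1#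
    0≢1 : 0# ≢ 1#
    inverse : ∀ x → x ≢ 0# → Σ Carrier (λ y → x * y ≡ 1#)
    size : ℕ
    enumeration : Carrier ↔ Fin size

module _ (F : FiniteField) where
  open FiniteField F

  IsNonzeroSquare : Carrier → Set
  IsNonzeroSquare z = Σ Carrier (λ t → t ≢ 0# × t * t ≡ z)

  InShiftedSquares : Carrier → Carrier → Set
  InShiftedSquares x w = Σ Carrier (λ z → IsNonzeroSquare z × w ≡ z + x)

  -- Y = {y_0,…,y_{n-1}} given as an indexed family; (distinctness is a
  -- separate hypothesis).
  Shattered : {n : ℕ} → (Fin n → Carrier) → Set
  Shattered {n} y =
    (A : Subset n) →
    Σ Carrier (λ x → (∀ j → y j ≢ x) × (∀ j → (j ∈ A) ⇔ InShiftedSquares x (y j)))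

  affineImage : {n : ℕ} → Carrier → Carrier → (Fin n → Carrier) → (Fin n → Carrier)
  affineImage a b y j = a * y j + b

-- Multiplying by a and adding b sends the point x to a x + b and every difference
-- y - x to a (y - x).  If a is a nonzero square, a (y - x) is a nonzero square
-- exactly when y - x is; if a is not a square, exactly when y - x is not, because
-- a product of two non-squares is a square (the nonzero squares have index two
-- in F_q^×).  Hence a x + b separates A in aY + b whenever x separates A (a a
-- square), resp. the complement of A (a not a square), in Y; shattering asks for
-- every subset, so either is available.  The converse applies the inverse map.
--
-- Index two is proved by counting: if 1, a, d lay in three different square
-- classes, (i , x) ↦ (sign x , c_i x²) with c = (1 , a , d) would inject the
-- 3q points of Fin 3 × F_q into a set of 2q + 1 points.  Here sign x compares
-- the enumeration indices of x and -x, so it tells apart the two roots of x².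
module Submission where

open import Defs
open import Data.Nat using (ℕ)
open import Data.Fin using (Fin)
open import Function.Bundles using (_⇔_)
open import Function.Definitions using (Injective)
open import Relation.Binary.PropositionalEquality using (_≡_; _≢_)

open import Level using (Level; 0ℓ)
import Data.Nat as ℕ
import Data.Nat.Properties as ℕ
open import Data.Fin using (zero; suc)
open import Data.Fin.Properties using (injective⇒≤; inj⇒≟; any?; _<?_; <-cmp; <-asym; *↔×; +↔⊎; 1↔⊤; 2↔Bool)
  renaming (_≟_ to _≟ᶠ_)
open import Data.Fin.Subset using (Subset; _∈_; ∁)
open import Data.Fin.Subset.Properties using (x∈p⇒x∉∁p; x∉∁p⇒x∈p)
open import Data.Bool using (Bool; true; false)
open import Data.Unit using (⊤; tt)
open import Data.Empty using (⊥; ⊥-elim)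
open import Data.Product using (∃; _×_; _,_)
open import Data.Product.Properties using (,-injectiveˡ; ,-injectiveʳ)
open import Data.Product.Function.NonDependent.Propositional using (_×-↔_)
open import Data.Sum using (_⊎_; inj₁; inj₂)
open import Data.Sum.Properties using (inj₂-injective)
open import Data.Sum.Function.Propositional using (_⊎-↔_)
open import Function using (_∘_)
open import Function.Bundles using (Inverse; Injection; _↔_; _↣_; mk⇔; mk↣)
open import Function.Properties.Inverse using (↔-refl; ↔-sym; ↔-trans; ↔⇒↣)
open import Function.Properties.Injection using (↣-trans)
open import Function.Properties.Equivalence using (⇔-setoid)
  renaming (trans to ⇔-trans; sym to ⇔-sym)
import Relation.Binary.Reasoning.Setoid
open import Function.Related.TypeIsomorphisms using (¬-cong-⇔)
open import Relation.Nullary using (¬_; Dec; yes; no; does; contradiction)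
open import Relation.Nullary.Decidable using (map′; dec-true; dec-false; ¬?; _×-dec_)
open import Relation.Unary using (Pred; Decidable)
open import Relation.Binary using (tri<; tri≈; tri>)
open import Relation.Binary.PropositionalEquality using (refl; sym; trans; cong; cong₂; subst)
open import Algebra.Bundles using (CommutativeMonoid; CommutativeRing)

private
  variable
    a ℓ : Level
    A B : Set a
    m n : ℕ

↣⇒size≤ : A ↔ Fin m → B ↔ Fin n → A ↣ B → m ℕ.≤ n
↣⇒size≤ A↔Fin B↔Fin A↣B =
  injective⇒≤ (Injection.injective (↣-trans (↔⇒↣ (↔-sym A↔Fin)) (↣-trans A↣B (↔⇒↣ B↔Fin))))

any?-↔ : {P : Pred A ℓ} → A ↔ Fin n → Decidable P → Dec (∃ P)
any?-↔ {P = P} A↔Fin P? =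
  map′ (λ (k , p) → from k , p)
       (λ (x , p) → to x , subst P (sym (strictlyInverseʳ x)) p)
       (any? (P? ∘ from))
  where open Inverse A↔Fin

does-<?-antisym : {i j : Fin n} → i ≢ j → does (i <? j) ≢ does (j <? i)
does-<?-antisym {i = i} {j} i≢j with <-cmp i j
... | tri< i<j _ _ rewrite dec-true (i <? j) i<j | dec-false (j <? i) (<-asym i<j) = λ ()
... | tri≈ _ i≡j _ = contradiction i≡j i≢j
... | tri> _ _ j<i rewrite dec-false (i <? j) (<-asym j<i) | dec-true (j <? i) j<i = λ ()

module CommutativeMonoidSquares (M : CommutativeMonoid a ℓ) where

  open CommutativeMonoid M
  open import Algebra.Properties.CommutativeSemigroup commutativeSemigroup using (interchange)
  open import Relation.Binary.Reasoning.Setoid setoid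

  square-∙ : ∀ s t → (s ∙ t) ∙ (s ∙ t) ≈ (s ∙ s) ∙ (t ∙ t)
  square-∙ s t = interchange s t s t

  square-quotient : ∀ {c e x y w} → c ∙ (x ∙ x) ≈ e ∙ (y ∙ y) → y ∙ w ≈ ε →
                    (c ∙ x ∙ w) ∙ (c ∙ x ∙ w) ≈ c ∙ e
  square-quotient {c} {e} {x} {y} {w} cx²≈ey² yw≈ε = begin
    (c ∙ x ∙ w) ∙ (c ∙ x ∙ w)       ≈⟨ square-∙ (c ∙ x) w ⟩
    ((c ∙ x) ∙ (c ∙ x)) ∙ (w ∙ w)   ≈⟨ ∙-congʳ (square-∙ c x) ⟩
    ((c ∙ c) ∙ (x ∙ x)) ∙ (w ∙ w)   ≈⟨ ∙-congʳ (assoc c c (x ∙ x)) ⟩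
    (c ∙ (c ∙ (x ∙ x))) ∙ (w ∙ w)   ≈⟨ ∙-congʳ (∙-congˡ cx²≈ey²) ⟩
    (c ∙ (e ∙ (y ∙ y))) ∙ (w ∙ w)   ≈⟨ ∙-congʳ (assoc c e (y ∙ y)) ⟨
    ((c ∙ e) ∙ (y ∙ y)) ∙ (w ∙ w)   ≈⟨ assoc (c ∙ e) (y ∙ y) (w ∙ w) ⟩
    (c ∙ e) ∙ ((y ∙ y) ∙ (w ∙ w))   ≈⟨ ∙-congˡ (square-∙ y w) ⟨
    (c ∙ e) ∙ ((y ∙ w) ∙ (y ∙ w))   ≈⟨ ∙-congˡ (∙-cong yw≈ε yw≈ε) ⟩
    (c ∙ e) ∙ (ε ∙ ε)               ≈⟨ ∙-congˡ (identityˡ ε) ⟩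
    (c ∙ e) ∙ ε                     ≈⟨ identityʳ (c ∙ e) ⟩
    c ∙ e                           ∎

module FiniteFieldProperties (F : FiniteField) where

  open FiniteField F

  private
    commutativeRing : CommutativeRing 0ℓ 0ℓ
    commutativeRing = record { isCommutativeRing = isCommutativeRing }

  open CommutativeRing commutativeRing
    using (+-comm; +-assoc; *-comm; *-assoc; *-identityˡ; *-identityʳ; zeroʳ; distribˡ; distribʳ)
  open import Algebra.Properties.Ring (CommutativeRing.ring commutativeRing)
    using (-‿involutive; +-inverseˡ-unique; +-cancelʳ; x∙y⁻¹≈ε⇒x≈y; //-rightDividesˡ; //-rightDividesʳ)

  Square : Carrier → Set
  Square = IsNonzeroSquare F

  infix 4 _≟_
  _≟_ : (x y : Carrier) → Dec (x ≡ y)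
  _≟_ = inj⇒≟ (↔⇒↣ enumeration)

  open CommutativeMonoidSquares (CommutativeRing.*-commutativeMonoid commutativeRing)
    using (square-∙; square-quotient)

  1≢0 : 1# ≢ 0#
  1≢0 = 0≢1 ∘ sym

  _⁻¹ : (x : Carrier) → x ≢ 0# → Carrier
  (x ⁻¹) x≢0 with y , _ ← inverse x x≢0 = y

  *-inverseʳ : ∀ x (x≢0 : x ≢ 0#) → x * (x ⁻¹) x≢0 ≡ 1#
  *-inverseʳ x x≢0 with _ , xy≡1 ← inverse x x≢0 = xy≡1

  ⁻¹*[*]-cancel : ∀ x (x≢0 : x ≢ 0#) y → (x ⁻¹) x≢0 * (x * y) ≡ y
  ⁻¹*[*]-cancel x x≢0 y = begin
    x⁻¹ * (x * y)  ≡⟨ *-assoc x⁻¹ x y ⟨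
    x⁻¹ * x * y    ≡⟨ cong (_* y) (trans (*-comm x⁻¹ x) (*-inverseʳ x x≢0)) ⟩
    1# * y         ≡⟨ *-identityˡ y ⟩
    y              ∎
    where
    open Relation.Binary.PropositionalEquality.≡-Reasoning
    x⁻¹ : Carrier
    x⁻¹ = (x ⁻¹) x≢0

  *-cancelˡ : ∀ {c x y} → c ≢ 0# → c * x ≡ c * y → x ≡ y
  *-cancelˡ {c} {x} {y} c≢0 cx≡cy =
    trans (sym (⁻¹*[*]-cancel c c≢0 x)) (trans (cong ((c ⁻¹) c≢0 *_) cx≡cy) (⁻¹*[*]-cancel c c≢0 y))

  *-≢0 : ∀ {x y} → x ≢ 0# → y ≢ 0# → x * y ≢ 0#
  *-≢0 {x} x≢0 y≢0 xy≡0 = y≢0 (*-cancelˡ x≢0 (trans xy≡0 (sym (zeroʳ x))))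

  ⁻¹-≢0 : ∀ x (x≢0 : x ≢ 0#) → (x ⁻¹) x≢0 ≢ 0#
  ⁻¹-≢0 x x≢0 x⁻¹≡0 = 1≢0 (trans (sym (*-inverseʳ x x≢0)) (trans (cong (x *_) x⁻¹≡0) (zeroʳ x)))

  x*x≡y*y⇒x≡y⊎x≡-y : ∀ {x y} → x * x ≡ y * y → x ≡ y ⊎ x ≡ - y
  x*x≡y*y⇒x≡y⊎x≡-y {x} {y} x²≡y² with x + y ≟ 0#
  ... | yes x+y≡0 = inj₂ (+-inverseˡ-unique x y x+y≡0)
  ... | no x+y≢0 = inj₁ (*-cancelˡ x+y≢0 (begin
    (x + y) * x    ≡⟨ distribʳ x x y ⟩
    x * x + y * x  ≡⟨ cong (_+ y * x) x²≡y² ⟩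
    y * y + y * x  ≡⟨ +-comm (y * y) (y * x) ⟩
    y * x + y * y  ≡⟨ cong (_+ y * y) (*-comm y x) ⟩
    x * y + y * y  ≡⟨ distribʳ y x y ⟨
    (x + y) * y    ∎))
    where open Relation.Binary.PropositionalEquality.≡-Reasoning

  sign : Carrier → Bool
  sign x = does (to x <? to (- x))
    where open Inverse enumeration

  sign-negate : ∀ {x} → x ≢ - x → sign x ≢ sign (- x)
  sign-negate {x} x≢-x rewrite -‿involutive x =
    does-<?-antisym (x≢-x ∘ Injection.injective (↔⇒↣ enumeration))

  square-sign-injective : ∀ {x y} → x * x ≡ y * y → sign x ≡ sign y → x ≡ y
  square-sign-injective {x} {y} x²≡y² sx≡sy with x*x≡y*y⇒x≡y⊎x≡-y x²≡y²
  ... | inj₁ x≡y = x≡y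
  ... | inj₂ x≡-y with x ≟ y
  ...   | yes x≡y = x≡y
  ...   | no x≢y = contradiction (subst (λ z → sign x ≡ sign z) y≡-x sx≡sy)
                                 (sign-negate (λ x≡-x → x≢y (trans x≡-x (sym y≡-x))))
    where
    y≡-x : y ≡ - x
    y≡-x = trans (sym (-‿involutive y)) (cong -_ (sym x≡-y))

  Square? : Decidable Square
  Square? z = any?-↔ enumeration (λ t → ¬? (t ≟ 0#) ×-dec (t * t ≟ z))

  Square-* : ∀ {s t} → Square s → Square t → Square (s * t)
  Square-* (u , u≢0 , uu≡s) (v , v≢0 , vv≡t) =
    u * v , *-≢0 u≢0 v≢0 , trans (square-∙ u v) (cong₂ _*_ uu≡s vv≡t)

  scaledSquares⇒Square : ∀ {c e x y} → c ≢ 0# → x ≢ 0# → y ≢ 0# →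
                         c * (x * x) ≡ e * (y * y) → Square (c * e)
  scaledSquares⇒Square {c} {x = x} {y} c≢0 x≢0 y≢0 cx²≡ey² =
    c * x * y⁻¹ , *-≢0 (*-≢0 c≢0 x≢0) (⁻¹-≢0 y y≢0) , square-quotient cx²≡ey² (*-inverseʳ y y≢0)
    where
    y⁻¹ : Carrier
    y⁻¹ = (y ⁻¹) y≢0

  Square-cancelˡ : ∀ {c d} → d ≢ 0# → Square c → Square (c * d) → Square d
  Square-cancelˡ {c} {d} d≢0 (t , t≢0 , tt≡c) (u , u≢0 , uu≡cd) =
    subst Square (*-identityʳ d) (scaledSquares⇒Square d≢0 t≢0 u≢0 dt²≡1u²)
    where
    dt²≡1u² : d * (t * t) ≡ 1# * (u * u)
    dt²≡1u² = trans (cong (d *_) tt≡c) (trans (*-comm d c) (trans (sym uu≡cd) (sym (*-identityˡ (u * u)))))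

  2≤size : 2 ℕ.≤ size
  2≤size = ↣⇒size≤ (↔-sym 2↔Bool) enumeration (mk↣ {to = bit} bit-injective)
    where
    bit : Bool → Carrier
    bit false = 0#
    bit true = 1#
    bit-injective : Injective _≡_ _≡_ bit
    bit-injective {false} {false} _ = refl
    bit-injective {false} {true} 0≡1 = contradiction 0≡1 0≢1
    bit-injective {true} {false} 1≡0 = contradiction 1≡0 1≢0
    bit-injective {true} {true} _ = refl

  module ThreeSquareClasses {a d : Carrier} (a≢0 : a ≢ 0#) (d≢0 : d ≢ 0#)
    (¬□a : ¬ Square a) (¬□d : ¬ Square d) (¬□ad : ¬ Square (a * d)) where

    representative : Fin 3 → Carrier
    representative zero = 1#
    representative (suc zero) = a
    representative (suc (suc zero)) = d

    representative-≢0 : ∀ i → representative i ≢ 0#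
    representative-≢0 zero = 1≢0
    representative-≢0 (suc zero) = a≢0
    representative-≢0 (suc (suc zero)) = d≢0

    representatives-apart : ∀ i k → i ≢ k → ¬ Square (representative i * representative k)
    representatives-apart zero zero 0≢0 = contradiction refl 0≢0
    representatives-apart zero (suc zero) _ = ¬□a ∘ subst Square (*-identityˡ a)
    representatives-apart zero (suc (suc zero)) _ = ¬□d ∘ subst Square (*-identityˡ d)
    representatives-apart (suc zero) zero _ = ¬□a ∘ subst Square (*-identityʳ a)
    representatives-apart (suc zero) (suc zero) 1≢1 = contradiction refl 1≢1
    representatives-apart (suc zero) (suc (suc zero)) _ = ¬□ad
    representatives-apart (suc (suc zero)) zero _ = ¬□d ∘ subst Square (*-identityʳ d)
    representatives-apart (suc (suc zero)) (suc zero) _ = ¬□ad ∘ subst Square (*-comm d a)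
    representatives-apart (suc (suc zero)) (suc (suc zero)) 2≢2 = contradiction refl 2≢2

    Code : Set
    Code = ⊤ ⊎ (Bool × Carrier)

    zeroCode : Fin 3 → Code
    zeroCode zero = inj₁ tt
    zeroCode (suc zero) = inj₂ (true , 0#)
    zeroCode (suc (suc zero)) = inj₂ (false , 0#)

    zeroCode-injective : ∀ {i k} → zeroCode i ≡ zeroCode k → i ≡ k
    zeroCode-injective {zero} {zero} _ = refl
    zeroCode-injective {suc zero} {suc zero} _ = refl
    zeroCode-injective {suc (suc zero)} {suc (suc zero)} _ = refl
    zeroCode-injective {zero} {suc zero} ()
    zeroCode-injective {zero} {suc (suc zero)} ()
    zeroCode-injective {suc zero} {zero} ()
    zeroCode-injective {suc zero} {suc (suc zero)} ()
    zeroCode-injective {suc (suc zero)} {zero} ()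
    zeroCode-injective {suc (suc zero)} {suc zero} ()

    zeroCode≢inj₂ : ∀ i {b z} → z ≢ 0# → zeroCode i ≢ inj₂ (b , z)
    zeroCode≢inj₂ zero _ ()
    zeroCode≢inj₂ (suc zero) z≢0 refl = z≢0 refl
    zeroCode≢inj₂ (suc (suc zero)) z≢0 refl = z≢0 refl

    encodeWith : Fin 3 → (x : Carrier) → Dec (x ≡ 0#) → Code
    encodeWith i x (yes _) = zeroCode i
    encodeWith i x (no _) = inj₂ (sign x , representative i * (x * x))

    encode : Fin 3 × Carrier → Code
    encode (i , x) = encodeWith i x (x ≟ 0#)

    encodeWith-injective : ∀ i k x y dx dy → encodeWith i x dx ≡ encodeWith k y dy → (i , x) ≡ (k , y)
    encodeWith-injective i k x y (yes x≡0) (yes y≡0) eq =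
      cong₂ _,_ (zeroCode-injective eq) (trans x≡0 (sym y≡0))
    encodeWith-injective i k x y (yes _) (no y≢0) eq =
      contradiction eq (zeroCode≢inj₂ i (*-≢0 (representative-≢0 k) (*-≢0 y≢0 y≢0)))
    encodeWith-injective i k x y (no x≢0) (yes _) eq =
      contradiction (sym eq) (zeroCode≢inj₂ k (*-≢0 (representative-≢0 i) (*-≢0 x≢0 x≢0)))
    encodeWith-injective i k x y (no x≢0) (no y≢0) eq with i ≟ᶠ k
    ... | no i≢k = contradiction (scaledSquares⇒Square (representative-≢0 i) x≢0 y≢0 ix²≡ky²)
                                 (representatives-apart i k i≢k)
      where
      ix²≡ky² : representative i * (x * x) ≡ representative k * (y * y)
      ix²≡ky² = ,-injectiveʳ (inj₂-injective eq)
    ... | yes refl = cong (i ,_) (square-sign-injective x²≡y² (,-injectiveˡ (inj₂-injective eq)))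
      where
      x²≡y² : x * x ≡ y * y
      x²≡y² = *-cancelˡ (representative-≢0 i) (,-injectiveʳ (inj₂-injective eq))

    encode-injective : Injective _≡_ _≡_ encode
    encode-injective {i , x} {k , y} = encodeWith-injective i k x y (x ≟ 0#) (y ≟ 0#)

    impossible : ⊥
    impossible = ℕ.<⇒≱ 2≤size (ℕ.+-cancelʳ-≤ (2 ℕ.* size) size 1 3q≤1+2q)
      where
      3q≤1+2q : 3 ℕ.* size ℕ.≤ 1 ℕ.+ 2 ℕ.* size
      3q≤1+2q = ↣⇒size≤
        (↔-trans (↔-refl ×-↔ enumeration) (↔-sym *↔×))
        (↔-trans (↔-sym 1↔⊤ ⊎-↔ ↔-trans (↔-sym 2↔Bool ×-↔ enumeration) (↔-sym *↔×)) (↔-sym +↔⊎))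
        (mk↣ encode-injective)

  nonSquare*nonSquare⇒Square : ∀ {a d} → a ≢ 0# → d ≢ 0# → ¬ Square a → ¬ Square d → Square (a * d)
  nonSquare*nonSquare⇒Square {a} {d} a≢0 d≢0 ¬□a ¬□d with Square? (a * d)
  ... | yes □ad = □ad
  ... | no ¬□ad = ⊥-elim (ThreeSquareClasses.impossible a≢0 d≢0 ¬□a ¬□d ¬□ad)

  Square-*ˡ-⇔ : ∀ {a d} → Square a → d ≢ 0# → Square d ⇔ Square (a * d)
  Square-*ˡ-⇔ □a d≢0 = mk⇔ (Square-* □a) (Square-cancelˡ d≢0 □a)

  nonSquare-*ˡ-⇔ : ∀ {a d} → a ≢ 0# → ¬ Square a → d ≢ 0# → (¬ Square d) ⇔ Square (a * d)
  nonSquare-*ˡ-⇔ {a} {d} a≢0 ¬□a d≢0 =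
    mk⇔ (nonSquare*nonSquare⇒Square a≢0 d≢0 ¬□a)
        (λ □ad □d → ¬□a (Square-cancelˡ a≢0 □d (subst Square (*-comm a d) □ad)))

  x≢y⇒x-y≢0 : ∀ {x y} → x ≢ y → x + - y ≢ 0#
  x≢y⇒x-y≢0 {x} {y} x≢y = x≢y ∘ x∙y⁻¹≈ε⇒x≈y x y

  inShiftedSquares⇔Square : ∀ {x w} → InShiftedSquares F x w ⇔ Square (w + - x)
  inShiftedSquares⇔Square {x} {w} = mk⇔
    (λ (z , □z , w≡z+x) → subst Square (sym (trans (cong (_+ - x) w≡z+x) (//-rightDividesʳ x z))) □z)
    (λ □w-x → w + - x , □w-x , sym (//-rightDividesˡ x w))

  affine-difference : ∀ a b u v → (a * u + b) + - (a * v + b) ≡ a * (u + - v)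
  affine-difference a b u v = begin
    (a * u + b) + - (a * v + b)                   ≡⟨ cong (_+ - (a * v + b)) split ⟨
    (a * (u + - v) + (a * v + b)) + - (a * v + b) ≡⟨ //-rightDividesʳ (a * v + b) (a * (u + - v)) ⟩
    a * (u + - v)                                 ∎
    where
    open Relation.Binary.PropositionalEquality.≡-Reasoning
    split : a * (u + - v) + (a * v + b) ≡ a * u + b
    split = begin
      a * (u + - v) + (a * v + b)    ≡⟨ +-assoc (a * (u + - v)) (a * v) b ⟨
      (a * (u + - v) + a * v) + b    ≡⟨ cong (_+ b) (distribˡ a (u + - v) v) ⟨
      a * ((u + - v) + v) + b        ≡⟨ cong (λ z → a * z + b) (//-rightDividesˡ v u) ⟩
      a * u + b                      ∎

  affine-injective : ∀ {a b u v} → a ≢ 0# → a * u + b ≡ a * v + b → u ≡ v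
  affine-injective {a} {b} {u} {v} a≢0 = *-cancelˡ a≢0 ∘ +-cancelʳ b (a * u) (a * v)

  affine-inverse : ∀ a (a≢0 : a ≢ 0#) b u → (a ⁻¹) a≢0 * (a * u + b) + - ((a ⁻¹) a≢0 * b) ≡ u
  affine-inverse a a≢0 b u = begin
    a⁻¹ * (a * u + b) + - (a⁻¹ * b)        ≡⟨ cong (_+ - (a⁻¹ * b)) (distribˡ a⁻¹ (a * u) b) ⟩
    a⁻¹ * (a * u) + a⁻¹ * b + - (a⁻¹ * b)  ≡⟨ //-rightDividesʳ (a⁻¹ * b) (a⁻¹ * (a * u)) ⟩
    a⁻¹ * (a * u)                          ≡⟨ ⁻¹*[*]-cancel a a≢0 u ⟩
    u                                      ∎
    where
    open Relation.Binary.PropositionalEquality.≡-Reasoning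
    a⁻¹ : Carrier
    a⁻¹ = (a ⁻¹) a≢0

  Separates : {n : ℕ} → (Fin n → Carrier) → Subset n → Carrier → Set
  Separates y A x = (∀ j → y j ≢ x) × (∀ j → (j ∈ A) ⇔ InShiftedSquares F x (y j))

  shattered-cong : ∀ {n} {y z : Fin n → Carrier} → (∀ j → y j ≡ z j) → Shattered F y → Shattered F z
  shattered-cong y≗z shY A with x , y≢x , sep ← shY A =
    x , (λ j → y≢x j ∘ trans (y≗z j)) , λ j → subst (λ u → (j ∈ A) ⇔ InShiftedSquares F x u) (y≗z j) (sep j)

  separates-affineImage : ∀ {n} {y : Fin n → Carrier} {A x a} b → a ≢ 0# → (∀ j → y j ≢ x) →
                          (∀ j → (j ∈ A) ⇔ Square (a * (y j + - x))) →
                          Separates (affineImage F a b y) A (a * x + b)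
  separates-affineImage {y = y} {A} {x} {a} b a≢0 y≢x sep =
    (λ j → y≢x j ∘ affine-injective a≢0) ,
    (λ j → ⇔-trans (sep j) (⇔-sym (subst (λ z → InShiftedSquares F (a * x + b) (a * y j + b) ⇔ Square z)
                                          (affine-difference a b (y j) x) inShiftedSquares⇔Square)))

  shattered-affineImage : ∀ {n} {y : Fin n → Carrier} {a} b → a ≢ 0# → Shattered F y → Shattered F (affineImage F a b y)
  shattered-affineImage {y = y} {a} b a≢0 shY A with Square? a
  ... | yes □a with x , y≢x , sep ← shY A = a * x + b , separates-affineImage b a≢0 y≢x λ j → begin
    j ∈ A                      ≈⟨ sep j ⟩
    InShiftedSquares F x (y j) ≈⟨ inShiftedSquares⇔Square ⟩
    Square (y j + - x)         ≈⟨ Square-*ˡ-⇔ □a (x≢y⇒x-y≢0 (y≢x j)) ⟩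
    Square (a * (y j + - x))   ∎
    where open Relation.Binary.Reasoning.Setoid (⇔-setoid 0ℓ)
  ... | no ¬□a with x , y≢x , sep ← shY (∁ A) = a * x + b , separates-affineImage b a≢0 y≢x λ j → begin
    j ∈ A                          ≈⟨ mk⇔ x∈p⇒x∉∁p x∉∁p⇒x∈p ⟩
    ¬ (j ∈ ∁ A)                    ≈⟨ ¬-cong-⇔ (sep j) ⟩
    ¬ InShiftedSquares F x (y j)   ≈⟨ ¬-cong-⇔ inShiftedSquares⇔Square ⟩
    ¬ Square (y j + - x)           ≈⟨ nonSquare-*ˡ-⇔ a≢0 ¬□a (x≢y⇒x-y≢0 (y≢x j)) ⟩
    Square (a * (y j + - x))       ∎
    where open Relation.Binary.Reasoning.Setoid (⇔-setoid 0ℓ)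

proposition1p6 : (F : FiniteField) → {n : ℕ} → (y : Fin n → FiniteField.Carrier F) → Injective _≡_ _≡_ y → (a b : FiniteField.Carrier F) → a ≢ FiniteField.0# F → Shattered F y ⇔ Shattered F (affineImage F a b y)
proposition1p6 F y _ a b a≢0 = mk⇔
  (shattered-affineImage b a≢0)
  (shattered-cong (affine-inverse a a≢0 b ∘ y) ∘ shattered-affineImage (- (a⁻¹ * b)) (⁻¹-≢0 a a≢0))
  where
  open FiniteField F using (_*_; -_)
  open FiniteFieldProperties F
  a⁻¹ : FiniteField.Carrier F
  a⁻¹ = (a ⁻¹) a≢0
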